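{- Let $\phi$ be a finite or infinite closed proposition, viewed as a (possibly infinite) $\lambda$-term via the encoding below. Then the Böhm tree of $\phi$ (its normal form in $\lambda_{\beta\bot_{\mathcal{US}}}$) is either $\mathbf{T}$, $\mathbf{F}$ or $\bot$.
   Context: $\Lambda^\infty$ denotes the set of finite and infinite $\lambda$-terms, given by reading the grammar $M::=x\mid\lambda x.M\mid (MM)$ coinductively (terms as possibly infinite trees, modulo $\alpha$); reductions may be infinite but must be strongly convergent (converging in the standard tree metric, with the depth of contracted redexes tending to infinity at limit stages). A closed term $M$ is solvable if $M N_1\ldots N_k$ reduces to $\mathbf{I}\equiv\lambda x.x$ for some $k\ge 0$ and terms $N_1,\dots,N_k$; an open term is solvable iff its closure is; otherwise it is unsolvable. $\mathcal{US}$ is the set of unsolvable terms. The infinitary calculus $\lambda_{\beta\bot_{\mathcal{US}}}$ has terms over the coinductive syntax extended with a constant $\bot$ (restricted to those that arise as limits of strongly convergent reductions from finite $\lambda$-terms), and reduction rules $\beta$ together with the rule $C[M]\to C[\bot]$ whenever $M[\bot:=\Omega]\in\mathcal{US}$, where $\Omega\equiv(\lambda x.xx)(\lambda x.xx)$. This calculus is confluent and normalising for strongly convergent reduction; the Böhm tree of a term is its unique normal form there. Encoding: $\mathbf{T}\equiv\lambda xy.x$, $\mathbf{F}\equiv\lambda xy.y$, $\neg M\equiv M\,\mathbf{F}\,\mathbf{T}$, $M\land N\equiv M\,N\,M$, $M\lor N\equiv M\,M\,N$, $M\rightarrow N\equiv M\,N\,\mathbf{T}$. Finite or infinite propositions are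 given by the grammar $\phi ::= p\mid \mathbf{T}\mid \mathbf{F}\mid (\phi\land\phi)\mid(\phi\lor\phi)\mid(\phi\rightarrow\phi)\mid\neg\phi$ read coinductively ($p$ ranging over propositional variables); a proposition is closed if it contains no propositional variables. -}

module Defs where

open import Level using (Level)
open import Data.Nat using (ℕ; zero; suc; _<_; _+_)
open import Data.List using (List; []; _∷_)
open import Data.List.Relation.Unary.All using (All)
open import Data.Product using (Σ; _×_)
open import Data.Sum using (_⊎_)
open import Relation.Nullary using (¬_)
open import Relation.Binary.PropositionalEquality using (_≡_)
open import Relation.Binary.Construct.Closure.ReflexiveTransitive using (Star)

-- Infinite trees without coinduction.  A (finite or infinite) tree is given by the
-- label found at each path from the root.  Labels at paths that do not
-- exist in the tree are junk and are ignored by every notion below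
-- (in particular by bisimilarity _≈_).

data Dir : Set where
  ◂ ▸ : Dir            -- left / right child (the body of λ is the ◂ child)

Path : Set
Path = List Dir

-- Λ∞ extended with ⊥, with de Bruijn indices (so α-equivalence is
-- built in).

data Label : Set where
  var : ℕ → Label
  lam app bot : Label

Term : Set
Term = Path → Label

_↓_ : Term → Dir → Term
(t ↓ d) p = t (d ∷ p)

data Valid (t : Term) : Path → Set where
  here : Valid t []
  lamV : ∀ {p} → t [] ≡ lam → Valid (t ↓ ◂) p → Valid t (◂ ∷ p)
  appV : ∀ {d p} → t [] ≡ app → Valid (t ↓ d) p → Valid t (d ∷ p)

_≈_ : Term → Term → Set
t ≈ u = ∀ p → Valid t p → t p ≡ u p

V : ℕ → Term
V n _ = var n

Λ : Term → Term
Λ t [] = lam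
Λ t (_ ∷ p) = t p

infixl 7 _·_
_·_ : Term → Term → Term
(t · u) [] = app
(t · u) (◂ ∷ p) = t p
(t · u) (▸ ∷ p) = u p

⊥t : Term
⊥t _ = bot

Tt Ft It ωt Ωt : Term
Tt = Λ (Λ (V 1))
Ft = Λ (Λ (V 0))
It = Λ (V 0)
ωt = Λ (V 0 · V 0)
Ωt = ωt · ωt

data Lift {ℓ : Level} (Q : Term → Term → Set ℓ) (t u : Term) : Set ℓ where
  var : ∀ {n} → t [] ≡ var n → u [] ≡ var n → Lift Q t u
  lam : t [] ≡ lam → u [] ≡ lam → Q (t ↓ ◂) (u ↓ ◂) → Lift Q t u
  app : t [] ≡ app → u [] ≡ app → Q (t ↓ ◂) (u ↓ ◂) → Q (t ↓ ▸) (u ↓ ▸) → Lift Q t u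
  bot : t [] ≡ bot → u [] ≡ bot → Lift Q t u

ext : (ℕ → ℕ) → ℕ → ℕ
ext ρ zero = zero
ext ρ (suc n) = suc (ρ n)

rename : (ℕ → ℕ) → Term → Term
rename ρ t [] with t []
... | var n = var (ρ n)
... | l = l
rename ρ t (d ∷ p) with t []
... | lam = rename (ext ρ) (t ↓ d) p
... | _ = rename ρ (t ↓ d) p

exts : (ℕ → Term) → ℕ → Term
exts σ zero = V zero
exts σ (suc n) = rename suc (σ n)

subst : (ℕ → Term) → Term → Term
subst σ t [] with t []
... | var n = σ n []
... | l = l
subst σ t (d ∷ p) with t []
... | var n = σ n (d ∷ p)
... | lam = subst (exts σ) (t ↓ d) p
... | _ = subst σ (t ↓ d) p

single : Term → ℕ → Term
single u zero = u
single u (suc n) = V n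

_[_] : Term → Term → Term
b [ u ] = subst (single u) b

unbot : Term → Term
unbot t p with t []
unbot t p | bot = Ωt p
unbot t [] | l = l
unbot t (d ∷ p) | _ = unbot (t ↓ d) p

lamDepth : Term → Path → ℕ
lamDepth t [] = 0
lamDepth t (d ∷ p) with t []
... | lam = suc (lamDepth (t ↓ d) p)
... | _ = lamDepth (t ↓ d) p

FreeBelow : ℕ → Term → Set
FreeBelow n t = ∀ p m → Valid t p → t p ≡ var m → m < lamDepth t p + n

BotFree : Term → Set
BotFree t = ∀ p → Valid t p → ¬ (t p ≡ bot)

lams : ℕ → Term → Term
lams zero M = M
lams (suc n) M = Λ (lams n M)

apps : Term → List Term → Term
apps M [] = M
apps M (N ∷ Ns) = apps (M · N) Ns

data Ctx (R : Term → Term → Set) (t u : Term) : Set where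
  root : R t u → Ctx R t u
  lamc : t [] ≡ lam → u [] ≡ lam → Ctx R (t ↓ ◂) (u ↓ ◂) → Ctx R t u
  appl : t [] ≡ app → u [] ≡ app → Ctx R (t ↓ ◂) (u ↓ ◂) → (t ↓ ▸) ≈ (u ↓ ▸) → Ctx R t u
  appr : t [] ≡ app → u [] ≡ app → (t ↓ ◂) ≈ (u ↓ ◂) → Ctx R (t ↓ ▸) (u ↓ ▸) → Ctx R t u

βRoot : Term → Term → Set
βRoot t u = t [] ≡ app × ((t ↓ ◂) [] ≡ lam × u ≈ (((t ↓ ◂) ↓ ◂) [ t ↓ ▸ ]))

_⟶β_ : Term → Term → Set
_⟶β_ = Ctx βRoot

-- Strongly convergent (possibly infinite) reduction, in its coinductive
-- presentation:  M ↠∞ N  is the greatest relation such that M reduces in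
-- finitely many steps to some M' with the same root constructor as N and
-- the immediate subterms of M' reduce ↠∞ to those of N.  The greatest
-- fixed point is written out as "some post-fixed point relates M and N".
Unfold : (Term → Term → Set) → (Term → Term → Set) → Term → Term → Set
Unfold R S M N = Σ Term λ M' → Star R M M' × Lift S M' N

Inf : (Term → Term → Set) → Term → Term → Set₁
Inf R M N = Σ (Term → Term → Set) λ S →
  S M N × (∀ a b → S a b → Unfold R S a b)

SolvableClosed : Term → Set₁
SolvableClosed M = Σ (List Term) λ Ns → All BotFree Ns × Inf _⟶β_ (apps M Ns) It

Solvable : Term → Set₁
Solvable M = Σ ℕ λ n → FreeBelow n M × SolvableClosed (lams n M)

Unsolvable : Term → Set₁
Unsolvable M = ¬ Solvable M

data βUSRoot (t u : Term) : Set₁ where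
  βr : βRoot t u → βUSRoot t u
  ⊥r : ¬ (t [] ≡ bot) → Unsolvable (unbot t) → u [] ≡ bot → βUSRoot t u

data CtxUS (t u : Term) : Set₁ where
  root : βUSRoot t u → CtxUS t u
  lamc : t [] ≡ lam → u [] ≡ lam → CtxUS (t ↓ ◂) (u ↓ ◂) → CtxUS t u
  appl : t [] ≡ app → u [] ≡ app → CtxUS (t ↓ ◂) (u ↓ ◂) → (t ↓ ▸) ≈ (u ↓ ▸) → CtxUS t u
  appr : t [] ≡ app → u [] ≡ app → (t ↓ ◂) ≈ (u ↓ ◂) → CtxUS (t ↓ ▸) (u ↓ ▸) → CtxUS t u

_⟶βUS_ : Term → Term → Set₁
_⟶βUS_ = CtxUS

UnfoldUS : (Term → Term → Set₁) → Term → Term → Set₁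
UnfoldUS S M N = Σ Term λ M' → Star _⟶βUS_ M M' × Lift S M' N

InfUS : Term → Term → Set₂
InfUS M N = Σ (Term → Term → Set₁) λ S →
  S M N × (∀ a b → S a b → UnfoldUS S a b)

NormalβUS : Term → Set₁
NormalβUS B = ∀ u → ¬ (B ⟶βUS u)

BöhmTree : Term → Term → Set₂
BöhmTree M B = InfUS M B × NormalβUS B

data PLabel : Set where
  pvar : ℕ → PLabel
  pT pF pand por pimp pneg : PLabel

Proposition : Set
Proposition = Path → PLabel

_↓ₚ_ : Proposition → Dir → Proposition
(φ ↓ₚ d) p = φ (d ∷ p)

data ValidP (φ : Proposition) : Path → Set where
  here : ValidP φ []
  binV : ∀ {d p} → (φ [] ≡ pand ⊎ (φ [] ≡ por ⊎ φ [] ≡ pimp)) → ValidP (φ ↓ₚ d) p → ValidP φ (d ∷ p)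
  negV : ∀ {p} → φ [] ≡ pneg → ValidP (φ ↓ₚ ◂) p → ValidP φ (◂ ∷ p)

ClosedProp : Proposition → Set
ClosedProp φ = ∀ p n → ValidP φ p → ¬ (φ p ≡ pvar n)

-- Encoding ¬M ≡ M F T, M∧N ≡ M N M, M∨N ≡ M M N, M→N ≡ M N T;
-- the variable pₙ is encoded as the free variable n.
mutual
  enc : Proposition → Term
  enc φ p with φ []
  enc φ p | pvar n = var n
  enc φ p | pT = Tt p
  enc φ p | pF = Ft p
  enc φ [] | _ = app
  enc φ (◂ ∷ p) | _ = inner φ p
  enc φ (▸ ∷ p) | pand = enc (φ ↓ₚ ◂) p
  enc φ (▸ ∷ p) | por = enc (φ ↓ₚ ▸) p
  enc φ (▸ ∷ p) | pimp = Tt p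
  enc φ (▸ ∷ p) | pneg = Tt p

  -- the inner application node (M N), (M M), (M N), (M F)
  inner : Proposition → Path → Label
  inner φ [] = app
  inner φ (◂ ∷ p) = enc (φ ↓ₚ ◂) p
  inner φ (▸ ∷ p) with φ []
  ... | por = enc (φ ↓ₚ ◂) p
  ... | pneg = Ft p
  ... | _ = enc (φ ↓ₚ ▸) p

{-# OPTIONS --safe #-}
-- Every reduct of an encoded closed proposition has, coinductively, the shape
--   B ::= T | F | ⊥ | O B        O ::= I | λx.B | B B | ⊥
-- because the only redexes are T B → λx.B, F B → I, I B → B and (λx.B) N → B[x:=N], which
-- preserve the grammar, and the ⊥-rule only ever produces ⊥.  So a Böhm tree of φ is ⊥, or
-- λ-rooted and then T or F (their subterms are solvable, hence normal), or application-rooted.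
-- In the last case its left spine consists of applications and ends in ⊥ or is infinite
-- (variables never occur and a λ would form a β-redex); reading ⊥ as Ω, such a term has no
-- head normal form, so it is unsolvable and would still reduce to ⊥.

module Submission where

open import Defs
open import Data.Empty using (⊥-elim) renaming (⊥ to Empty)
open import Data.Unit using (⊤; tt)
open import Data.Nat using (ℕ; zero; suc; _<_; _+_; s≤s; z≤n)
open import Data.Nat.Properties using (+-suc)
open import Data.List using ([]; _∷_)
open import Data.List.Relation.Unary.All using ([]; _∷_)
open import Data.Product using (Σ; ∃-syntax; _×_; _,_)
open import Data.Sum using (_⊎_; inj₁; inj₂)
open import Relation.Nullary using (¬_; contradiction)
open import Relation.Binary.Bundles using (Setoid)
open import Relation.Binary.PropositionalEquality as ≡
  using (_≡_; _≢_; _≗_; refl; sym; trans; cong)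
open import Relation.Binary.Construct.Closure.ReflexiveTransitive using (Star; ε; _◅_)
import Relation.Binary.Reasoning.Setoid

variable
  t u w : Term
  l l′ : Label
  d : Dir
  p : Path
  n : ℕ

clash : ∀ {a} {A : Set a} {x : Label} → x ≡ l → x ≡ l′ → l ≢ l′ → A
clash e e′ l≢l′ = contradiction (trans (sym e) e′) l≢l′

≈-root : t ≈ u → t [] ≡ u []
≈-root e = e [] here

≈-label : t ≈ u → t [] ≡ l → u [] ≡ l
≈-label e = trans (sym (≈-root e))

≈-body : t ≈ u → t [] ≡ lam → (t ↓ ◂) ≈ (u ↓ ◂)
≈-body e r p v = e (◂ ∷ p) (lamV r v)

≈-child : t ≈ u → t [] ≡ app → ∀ d → (t ↓ d) ≈ (u ↓ d)
≈-child e r d p v = e (d ∷ p) (appV r v)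

≈-Valid : t ≈ u → Valid t p → Valid u p
≈-Valid e here = here
≈-Valid e (lamV r v) = lamV (≈-label e r) (≈-Valid (≈-body e r) v)
≈-Valid e (appV r v) = appV (≈-label e r) (≈-Valid (≈-child e r _) v)

≈-Valid⁻ : t ≈ u → Valid u p → Valid t p
≈-Valid⁻ e here = here
≈-Valid⁻ e (lamV r v) = lamV r′ (≈-Valid⁻ (≈-body e r′) v) where r′ = trans (≈-root e) r
≈-Valid⁻ e (appV r v) = appV r′ (≈-Valid⁻ (≈-child e r′ _) v) where r′ = trans (≈-root e) r

≈-refl : t ≈ t
≈-refl _ _ = refl

≈-reflexive : t ≗ u → t ≈ u
≈-reflexive t≗u p _ = t≗u p

≈-sym : t ≈ u → u ≈ t
≈-sym e p v = sym (e p (≈-Valid⁻ e v))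

≈-trans : t ≈ u → u ≈ w → t ≈ w
≈-trans e e′ p v = trans (e p v) (e′ p (≈-Valid e v))

≈-intro : t [] ≡ u [] → (t [] ≡ lam → (t ↓ ◂) ≈ (u ↓ ◂)) →
          (t [] ≡ app → ∀ d → (t ↓ d) ≈ (u ↓ d)) → t ≈ u
≈-intro r _ _ [] here = r
≈-intro _ b _ (◂ ∷ p) (lamV r v) = b r p v
≈-intro _ _ c (d ∷ p) (appV r v) = c r d p v

≈-var : t [] ≡ var n → t ≈ V n
≈-var r = ≈-intro r (λ r′ → clash r r′ λ ()) (λ r′ → clash r r′ λ ())

≈-bot : t [] ≡ bot → t ≈ ⊥t
≈-bot r = ≈-intro r (λ r′ → clash r r′ λ ()) (λ r′ → clash r r′ λ ())

≈-lam : t [] ≡ lam → (t ↓ ◂) ≈ u → t ≈ Λ u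
≈-lam r b = ≈-intro r (λ _ → b) (λ r′ → clash r r′ λ ())

≈-app : t [] ≡ app → (t ↓ ◂) ≈ u → (t ↓ ▸) ≈ w → t ≈ (u · w)
≈-app r f a = ≈-intro r (λ r′ → clash r r′ λ ()) λ { _ ◂ → f ; _ ▸ → a }

Λ-cong : t ≈ u → Λ t ≈ Λ u
Λ-cong = ≈-lam refl

·-cong : ∀ {t′ u′} → t ≈ u → t′ ≈ u′ → (t · t′) ≈ (u · u′)
·-cong = ≈-app refl

≈-setoid : Setoid _ _
≈-setoid = record
  { Carrier = Term ; _≈_ = _≈_
  ; isEquivalence = record { refl = ≈-refl ; sym = ≈-sym ; trans = ≈-trans } }

module ≈-Reasoning = Relation.Binary.Reasoning.Setoid ≈-setoid

Valid-↓ : Valid t (d ∷ p) → Valid (t ↓ d) p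
Valid-↓ (lamV _ v) = v
Valid-↓ (appV _ v) = v

Valid-∷ : ∀ {q} → t [] ≡ u [] → Valid t (d ∷ p) → Valid (u ↓ d) q → Valid u (d ∷ q)
Valid-∷ r (lamV r′ _) w = lamV (trans (sym r) r′) w
Valid-∷ r (appV r′ _) w = appV (trans (sym r) r′) w

NonVar : Label → Set
NonVar l = ∀ n → l ≢ var n

record TreeMap : Set₁ where
  field
    Env   : Set
    apply : Env → Term → Term
    under : Env → Env
    apply-root  : ∀ ρ t {l} → t [] ≡ l → NonVar l → apply ρ t [] ≡ l
    apply-body  : ∀ ρ t → t [] ≡ lam → (apply ρ t ↓ ◂) ≗ apply (under ρ) (t ↓ ◂)
    apply-child : ∀ ρ t d → t [] ≡ app → (apply ρ t ↓ d) ≗ apply ρ (t ↓ d)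
    apply-var   : ∀ ρ t {n} → t [] ≡ var n → apply ρ t ≈ apply ρ (V n)
    under-V0    : ∀ ρ → apply (under ρ) (V 0) ≈ V 0
    under²-V1   : ∀ ρ → apply (under (under ρ)) (V 1) ≈ V 1

  apply-cong    : ∀ ρ {t u} → t ≈ u → apply ρ t ≈ apply ρ u
  apply-cong-at : ∀ ρ {t u} → t ≈ u → t [] ≡ l → NonVar l → apply ρ t ≈ apply ρ u

  apply-cong ρ {t} {u} e p v with t [] in r
  ... | var n = ≈-trans (apply-var ρ t r) (≈-sym (apply-var ρ u (≈-label e r))) p v
  ... | lam   = apply-cong-at ρ e r (λ _ ()) p v
  ... | app   = apply-cong-at ρ e r (λ _ ()) p v
  ... | bot   = apply-cong-at ρ e r (λ _ ()) p v

  apply-cong-at ρ {t} {u} e r nv [] _ = trans (apply-root ρ t r nv) (sym (apply-root ρ u (≈-label e r) nv))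
  apply-cong-at ρ {t} {u} e r nv (◂ ∷ p) (lamV r′ v) =
    trans (apply-body ρ t rλ p)
          (trans (apply-cong (under ρ) (≈-body e rλ) p (≈-Valid (≈-reflexive (apply-body ρ t rλ)) v))
                 (sym (apply-body ρ u (≈-label e rλ) p)))
    where rλ = trans r (trans (sym (apply-root ρ t r nv)) r′)
  apply-cong-at ρ {t} {u} e r nv (d ∷ p) (appV r′ v) =
    trans (apply-child ρ t d r· p)
          (trans (apply-cong ρ (≈-child e r· d) p (≈-Valid (≈-reflexive (apply-child ρ t d r·)) v))
                 (sym (apply-child ρ u d (≈-label e r·) p)))
    where r· = trans r (trans (sym (apply-root ρ t r nv)) r′)

  apply-Λ : ∀ ρ t → apply ρ (Λ t) ≈ Λ (apply (under ρ) t)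
  apply-Λ ρ t = ≈-lam (apply-root ρ (Λ t) refl λ _ ()) (≈-reflexive (apply-body ρ (Λ t) refl))

  apply-· : ∀ ρ t u → apply ρ (t · u) ≈ (apply ρ t · apply ρ u)
  apply-· ρ t u = ≈-app (apply-root ρ (t · u) refl λ _ ())
                        (≈-reflexive (apply-child ρ (t · u) ◂ refl))
                        (≈-reflexive (apply-child ρ (t · u) ▸ refl))

  apply-Tt : ∀ ρ → apply ρ Tt ≈ Tt
  apply-Tt ρ = ≈-trans (apply-Λ ρ _) (Λ-cong (≈-trans (apply-Λ (under ρ) _) (Λ-cong (under²-V1 ρ))))

  apply-Ft : ∀ ρ → apply ρ Ft ≈ Ft
  apply-Ft ρ = ≈-trans (apply-Λ ρ _) (Λ-cong (≈-trans (apply-Λ (under ρ) _) (Λ-cong (under-V0 (under ρ)))))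

  apply-It : ∀ ρ → apply ρ It ≈ It
  apply-It ρ = ≈-trans (apply-Λ ρ _) (Λ-cong (under-V0 ρ))

  apply-Ωt : ∀ ρ → apply ρ Ωt ≈ Ωt
  apply-Ωt ρ = ≈-trans (apply-· ρ ωt ωt) (·-cong apply-ω apply-ω)
    where
    apply-ω : apply ρ ωt ≈ ωt
    apply-ω = ≈-trans (apply-Λ ρ _)
                (Λ-cong (≈-trans (apply-· (under ρ) (V 0) (V 0)) (·-cong (under-V0 ρ) (under-V0 ρ))))

id-map : TreeMap
id-map = record
  { Env = ⊤ ; apply = λ _ t → t ; under = λ _ → _
  ; apply-root = λ _ _ r _ → r ; apply-body = λ _ _ _ _ → refl ; apply-child = λ _ _ _ _ _ → refl
  ; apply-var = λ _ _ r → ≈-var r ; under-V0 = λ _ → ≈-refl ; under²-V1 = λ _ → ≈-refl }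

rename-root : ∀ ρ t {l} → t [] ≡ l → NonVar l → rename ρ t [] ≡ l
rename-root ρ t {var n} r nv = ⊥-elim (nv n refl)
rename-root ρ t {lam}   r nv rewrite r = refl
rename-root ρ t {app}   r nv rewrite r = refl
rename-root ρ t {bot}   r nv rewrite r = refl

rename-var : ∀ ρ t {n} → t [] ≡ var n → rename ρ t [] ≡ var (ρ n)
rename-var ρ t r rewrite r = refl

rename-body : ∀ ρ t → t [] ≡ lam → (rename ρ t ↓ ◂) ≗ rename (ext ρ) (t ↓ ◂)
rename-body ρ t r p rewrite r = refl

rename-child : ∀ ρ t d → t [] ≡ app → (rename ρ t ↓ d) ≗ rename ρ (t ↓ d)
rename-child ρ t d r p rewrite r = refl

rename-map : TreeMap
rename-map = record
  { Env = ℕ → ℕ ; apply = rename ; under = ext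
  ; apply-root = rename-root ; apply-body = rename-body ; apply-child = rename-child
  ; apply-var = λ ρ t r → ≈-trans (≈-var (rename-var ρ t r)) (≈-sym (≈-var refl))
  ; under-V0 = λ _ → ≈-var refl ; under²-V1 = λ _ → ≈-var refl }

subst-root : ∀ σ t {l} → t [] ≡ l → NonVar l → subst σ t [] ≡ l
subst-root σ t {var n} r nv = ⊥-elim (nv n refl)
subst-root σ t {lam}   r nv rewrite r = refl
subst-root σ t {app}   r nv rewrite r = refl
subst-root σ t {bot}   r nv rewrite r = refl

subst-var : ∀ σ t {n} → t [] ≡ var n → subst σ t ≗ σ n
subst-var σ t r []      rewrite r = refl
subst-var σ t r (_ ∷ _) rewrite r = refl

subst-body : ∀ σ t → t [] ≡ lam → (subst σ t ↓ ◂) ≗ subst (exts σ) (t ↓ ◂)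
subst-body σ t r p rewrite r = refl

subst-child : ∀ σ t d → t [] ≡ app → (subst σ t ↓ d) ≗ subst σ (t ↓ d)
subst-child σ t d r p rewrite r = refl

subst-map : TreeMap
subst-map = record
  { Env = ℕ → Term ; apply = subst ; under = exts
  ; apply-root = subst-root ; apply-body = subst-body ; apply-child = subst-child
  ; apply-var = λ σ t r → ≈-reflexive λ p → trans (subst-var σ t r p) (sym (subst-var σ (V _) refl p))
  ; under-V0 = λ _ → ≈-var refl ; under²-V1 = λ _ → ≈-var refl }

open TreeMap subst-map
  using () renaming (apply-cong to subst-cong; apply-Λ to subst-Λ; apply-· to subst-·)

subst-V : ∀ σ n → subst σ (V n) ≈ σ n
subst-V σ n = ≈-reflexive (subst-var σ (V n) refl)

-- Terms without head normal form are unsolvable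

Normalβ : Term → Set
Normalβ t = ∀ u → ¬ (t ⟶β u)

Normalβ-var : t [] ≡ var n → Normalβ t
Normalβ-var r _ (root (r′ , _)) = clash r r′ λ ()
Normalβ-var r _ (lamc r′ _ _)   = clash r r′ λ ()
Normalβ-var r _ (appl r′ _ _ _) = clash r r′ λ ()
Normalβ-var r _ (appr r′ _ _ _) = clash r r′ λ ()

Normalβ-ω : t ≈ ωt → Normalβ t
Normalβ-ω e _ (root (r , _))   = clash (≈-root e) r λ ()
Normalβ-ω e _ (appl r _ _ _)   = clash (≈-root e) r λ ()
Normalβ-ω e _ (appr r _ _ _)   = clash (≈-root e) r λ ()
Normalβ-ω e _ (lamc _ _ c)     = Normalβ-V0V0 (≈-body e (≈-root e)) _ c
  where
  Normalβ-V0V0 : u ≈ (V 0 · V 0) → Normalβ u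
  Normalβ-V0V0 e _ (root (_ , r , _)) = clash (≈-root (≈-child e (≈-root e) ◂)) r λ ()
  Normalβ-V0V0 e _ (lamc r _ _)       = clash (≈-root e) r λ ()
  Normalβ-V0V0 e _ (appl _ _ c _)     = Normalβ-var (≈-root (≈-child e (≈-root e) ◂)) _ c
  Normalβ-V0V0 e _ (appr _ _ _ c)     = Normalβ-var (≈-root (≈-child e (≈-root e) ▸)) _ c

Ω-βRoot : t ≈ Ωt → βRoot t u → u ≈ Ωt
Ω-βRoot {t} {u} e (r , r′ , u≈) = begin
  u                                ≈⟨ u≈ ⟩
  ((t ↓ ◂) ↓ ◂) [ t ↓ ▸ ]          ≈⟨ subst-cong _ (≈-body (≈-child e r ◂) r′) ⟩
  (V 0 · V 0) [ t ↓ ▸ ]            ≈⟨ subst-· _ (V 0) (V 0) ⟩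
  subst σ (V 0) · subst σ (V 0)    ≈⟨ ·-cong (subst-V σ 0) (subst-V σ 0) ⟩
  (t ↓ ▸) · (t ↓ ▸)                ≈⟨ ·-cong (≈-child e r ▸) (≈-child e r ▸) ⟩
  Ωt                               ∎
  where
  open ≈-Reasoning
  σ = single (t ↓ ▸)

-- The left spine of t is infinite or reaches Ω, stated through its finite prefixes.
ΩSpine : ℕ → Term → Set
ΩSpine zero    t = ⊤
ΩSpine (suc n) t = t ≈ Ωt ⊎ (t [] ≡ app × ΩSpine n (t ↓ ◂))

SpineDivergent : Term → Set
SpineDivergent t = ∀ n → ΩSpine n t

data HeadDivergent (t : Term) : Set where
  spine : SpineDivergent t → HeadDivergent t
  abs   : t [] ≡ lam → HeadDivergent (t ↓ ◂) → HeadDivergent t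
  app   : t [] ≡ app → HeadDivergent (t ↓ ◂) → HeadDivergent t

ΩSpine-cong : ∀ n → t ≈ u → ΩSpine n t → ΩSpine n u
ΩSpine-cong zero    e _                = tt
ΩSpine-cong (suc n) e (inj₁ e′)        = inj₁ (≈-trans (≈-sym e) e′)
ΩSpine-cong (suc n) e (inj₂ (r , h))   = inj₂ (≈-label e r , ΩSpine-cong n (≈-child e r ◂) h)

HeadDivergent-cong : t ≈ u → HeadDivergent t → HeadDivergent u
HeadDivergent-cong e (spine h) = spine λ n → ΩSpine-cong n e (h n)
HeadDivergent-cong e (abs r h) = abs (≈-label e r) (HeadDivergent-cong (≈-body e r) h)
HeadDivergent-cong e (app r h) = app (≈-label e r) (HeadDivergent-cong (≈-child e r ◂) h)

SpineDivergent-Ω : t ≈ Ωt → SpineDivergent t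
SpineDivergent-Ω e zero    = tt
SpineDivergent-Ω e (suc n) = inj₁ e

SpineDivergent-intro : t [] ≡ app → SpineDivergent (t ↓ ◂) → SpineDivergent t
SpineDivergent-intro r h zero    = tt
SpineDivergent-intro r h (suc n) = inj₂ (r , h n)

SpineDivergent⇒app : SpineDivergent t → t [] ≡ app
SpineDivergent⇒app h with h 1
... | inj₁ e       = ≈-root e
... | inj₂ (r , _) = r

SpineDivergent-head : SpineDivergent t → ¬ t ≈ Ωt → SpineDivergent (t ↓ ◂)
SpineDivergent-head h ¬Ω n with h (suc n)
... | inj₁ e       = ⊥-elim (¬Ω e)
... | inj₂ (_ , h′) = h′

SpineDivergent-redex⇒Ω : SpineDivergent t → (t ↓ ◂) [] ≡ lam → t ≈ Ωt
SpineDivergent-redex⇒Ω h r with h 2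
... | inj₁ e                    = e
... | inj₂ (_ , inj₁ e)         = clash (≈-root e) r λ ()
... | inj₂ (_ , inj₂ (r′ , _))  = clash r′ r λ ()

SpineDivergent-step : SpineDivergent t → t ⟶β u → SpineDivergent u
SpineDivergent-step h (root β@(_ , r , _)) = SpineDivergent-Ω (Ω-βRoot (SpineDivergent-redex⇒Ω h r) β)
SpineDivergent-step h (lamc r _ _)         = clash (SpineDivergent⇒app h) r λ ()
SpineDivergent-step h (appl r r′ c _)      =
  SpineDivergent-intro r′ (SpineDivergent-step (SpineDivergent-head h λ e → Normalβ-ω (≈-child e r ◂) _ c) c)
SpineDivergent-step h (appr r r′ t◂≈ c)    =
  SpineDivergent-intro r′ λ n → ΩSpine-cong n t◂≈ (SpineDivergent-head h (λ e → Normalβ-ω (≈-child e r ▸) _ c) n)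

module _ (M : TreeMap) where
  open TreeMap M

  ΩSpine-map : ∀ n ρ t → ΩSpine n t → ΩSpine n (apply ρ t)
  ΩSpine-map zero    ρ t _              = tt
  ΩSpine-map (suc n) ρ t (inj₁ e)       = inj₁ (≈-trans (apply-cong ρ e) (apply-Ωt ρ))
  ΩSpine-map (suc n) ρ t (inj₂ (r , h)) =
    inj₂ (apply-root ρ t r (λ _ ()) ,
          ΩSpine-cong n (≈-sym (≈-reflexive (apply-child ρ t ◂ r))) (ΩSpine-map n ρ (t ↓ ◂) h))

  HeadDivergent-map : ∀ ρ t → HeadDivergent t → HeadDivergent (apply ρ t)
  HeadDivergent-map ρ t (spine h) = spine λ n → ΩSpine-map n ρ t (h n)
  HeadDivergent-map ρ t (abs r h) = abs (apply-root ρ t r λ _ ())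
    (HeadDivergent-cong (≈-sym (≈-reflexive (apply-body ρ t r))) (HeadDivergent-map (under ρ) (t ↓ ◂) h))
  HeadDivergent-map ρ t (app r h) = app (apply-root ρ t r λ _ ())
    (HeadDivergent-cong (≈-sym (≈-reflexive (apply-child ρ t ◂ r))) (HeadDivergent-map ρ (t ↓ ◂) h))

HeadDivergent-body : HeadDivergent t → t [] ≡ lam → HeadDivergent (t ↓ ◂)
HeadDivergent-body (spine h) r   = clash (SpineDivergent⇒app h) r λ ()
HeadDivergent-body (abs _ h) _   = h
HeadDivergent-body (app r′ _) r  = clash r′ r λ ()

HeadDivergent-¬var : HeadDivergent t → t [] ≢ var n
HeadDivergent-¬var (spine h) r   = clash (SpineDivergent⇒app h) r λ ()
HeadDivergent-¬var (abs r′ _) r  = clash r′ r λ ()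
HeadDivergent-¬var (app r′ _) r  = clash r′ r λ ()

HeadDivergent-step : HeadDivergent t → t ⟶β u → HeadDivergent u
HeadDivergent-step (spine h) c                      = spine (SpineDivergent-step h c)
HeadDivergent-step (abs _ h) (lamc _ r c)           = abs r (HeadDivergent-step h c)
HeadDivergent-step (abs r _) (root (r′ , _))        = clash r r′ λ ()
HeadDivergent-step (abs r _) (appl r′ _ _ _)        = clash r r′ λ ()
HeadDivergent-step (abs r _) (appr r′ _ _ _)        = clash r r′ λ ()
HeadDivergent-step (app _ h) (root (_ , r , u≈))    =
  HeadDivergent-cong (≈-sym u≈) (HeadDivergent-map subst-map _ _ (HeadDivergent-body h r))
HeadDivergent-step (app r _) (lamc r′ _ _)          = clash r r′ λ ()
HeadDivergent-step (app _ h) (appl _ r c _)         = app r (HeadDivergent-step h c)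
HeadDivergent-step (app _ h) (appr _ r t◂≈ _)       = app r (HeadDivergent-cong t◂≈ h)

HeadDivergent-star : HeadDivergent t → Star _⟶β_ t u → HeadDivergent u
HeadDivergent-star h ε        = h
HeadDivergent-star h (c ◅ cs) = HeadDivergent-star (HeadDivergent-step h c) cs

HeadDivergent-apps : ∀ Ns → HeadDivergent t → HeadDivergent (apps t Ns)
HeadDivergent-apps []       h = h
HeadDivergent-apps (_ ∷ Ns) h = HeadDivergent-apps Ns (app refl h)

HeadDivergent-lams : ∀ n → HeadDivergent t → HeadDivergent (lams n t)
HeadDivergent-lams zero    h = h
HeadDivergent-lams (suc n) h = abs refl (HeadDivergent-lams n h)

module _ {S : Term → Term → Set} (post : ∀ a b → S a b → Unfold _⟶β_ S a b) where

  HeadDivergent-↛var : HeadDivergent t → S t u → u [] ≢ var n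
  HeadDivergent-↛var h s r with post _ _ s
  ... | _ , cs , var r′ _     = HeadDivergent-¬var (HeadDivergent-star h cs) r′
  ... | _ , _ , lam _ r′ _    = clash r r′ λ ()
  ... | _ , _ , app _ r′ _ _  = clash r r′ λ ()
  ... | _ , _ , bot _ r′      = clash r r′ λ ()

  HeadDivergent-↛I : HeadDivergent t → ¬ S t It
  HeadDivergent-↛I h s with post _ _ s
  ... | _ , cs , lam r _ s′ = HeadDivergent-↛var (HeadDivergent-body (HeadDivergent-star h cs) r) s′ refl

SpineDivergent-unsolvable : SpineDivergent t → Unsolvable t
SpineDivergent-unsolvable h (n , _ , Ns , _ , _ , s , post) =
  HeadDivergent-↛I post (HeadDivergent-apps Ns (HeadDivergent-lams n (spine h))) s

It-β : t ≈ It → ((t ↓ ◂) [ u ]) ≈ u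
It-β e = ≈-trans (subst-cong _ (≈-body e (≈-root e))) (subst-V _ 0)

Ft-β : t ≈ Ft → ((t ↓ ◂) [ u ]) ≈ It
Ft-β e = ≈-trans (subst-cong _ (≈-body e (≈-root e))) (TreeMap.apply-It subst-map _)

Tt-β : t ≈ Tt → ((t ↓ ◂) [ u ]) ≈ Λ (rename suc u)
Tt-β {t} {u} e = begin
  (t ↓ ◂) [ u ]                     ≈⟨ subst-cong _ (≈-body e (≈-root e)) ⟩
  subst (single u) (Λ (V 1))        ≈⟨ subst-Λ _ (V 1) ⟩
  Λ (subst (exts (single u)) (V 1)) ≈⟨ Λ-cong (subst-V _ 1) ⟩
  Λ (rename suc u)                  ∎
  where open ≈-Reasoning

module _ (R : Term → Term → Set) where

  private
    ReducesTo≈ : Term → Term → Set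
    ReducesTo≈ a b = Σ Term λ a′ → Star R a a′ × a′ ≈ b

    ≈-Lift : t ≈ u → Lift ReducesTo≈ t u
    ≈-Lift {t} e with t [] in r
    ... | var _ = var r (≈-label e r)
    ... | lam   = lam r (≈-label e r) (_ , ε , ≈-body e r)
    ... | app   = app r (≈-label e r) (_ , ε , ≈-child e r ◂) (_ , ε , ≈-child e r ▸)
    ... | bot   = bot r (≈-label e r)

  Star⇒Inf : ∀ {a a′ b} → Star R a a′ → a′ ≈ b → Inf R a b
  Star⇒Inf cs e = ReducesTo≈ , (_ , cs , e) , λ { _ _ (a′ , cs , e) → a′ , cs , ≈-Lift e }

BotFree-V : ∀ n → BotFree (V n)
BotFree-V n [] here ()

BotFree-Λ : BotFree t → BotFree (Λ t)
BotFree-Λ bf [] here ()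
BotFree-Λ bf (◂ ∷ p) (lamV _ v) = bf p v

BotFree-cong : t ≈ u → BotFree u → BotFree t
BotFree-cong e bf p v t≡bot = bf p (≈-Valid e v) (trans (sym (e p v)) t≡bot)

SolvableClosed-Tt : t ≈ Tt → SolvableClosed t
SolvableClosed-Tt {t} e =
  It ∷ It ∷ [] , I-BotFree ∷ I-BotFree ∷ [] , Star⇒Inf _⟶β_ (β₁ ◅ β₂ ◅ ε) (Ft-β T·I≈F)
  where
  I-BotFree = BotFree-Λ (BotFree-V 0)
  T·I≈F : ((t ↓ ◂) [ It ]) ≈ Ft
  T·I≈F = ≈-trans (Tt-β e) (Λ-cong (TreeMap.apply-It rename-map suc))
  β₁ : (t · It · It) ⟶β ((t ↓ ◂) [ It ] · It)
  β₁ = appl refl refl (root (refl , ≈-root e , ≈-refl)) ≈-refl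
  β₂ : ((t ↓ ◂) [ It ] · It) ⟶β ((((t ↓ ◂) [ It ]) ↓ ◂) [ It ])
  β₂ = root (refl , ≈-root T·I≈F , ≈-refl)

SolvableClosed-It : t ≈ It → SolvableClosed t
SolvableClosed-It e = [] , [] , Star⇒Inf _⟶β_ ε e

lamDepth-lam : ∀ t → t [] ≡ lam → lamDepth t (d ∷ p) ≡ suc (lamDepth (t ↓ d) p)
lamDepth-lam t r rewrite r = refl

lamDepth-app : ∀ t → t [] ≡ app → lamDepth t (d ∷ p) ≡ lamDepth (t ↓ d) p
lamDepth-app t r rewrite r = refl

lamDepth-cong : t ≈ u → Valid t p → lamDepth t p ≡ lamDepth u p
lamDepth-cong e here = refl
lamDepth-cong {t} {u} e (lamV r v) =
  trans (lamDepth-lam t r) (trans (cong suc (lamDepth-cong (≈-body e r) v)) (sym (lamDepth-lam u (≈-label e r))))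
lamDepth-cong {t} {u} e (appV r v) =
  trans (lamDepth-app t r) (trans (lamDepth-cong (≈-child e r _) v) (sym (lamDepth-app u (≈-label e r))))

FreeBelow-cong : t ≈ u → FreeBelow n u → FreeBelow n t
FreeBelow-cong {n = n} e fb p m v r =
  ≡.subst (λ k → m < k + n) (sym (lamDepth-cong e v)) (fb p m (≈-Valid e v) (trans (sym (e p v)) r))

FreeBelow-V : ∀ {m} → m < n → FreeBelow n (V m)
FreeBelow-V m<n [] _ here refl = m<n

FreeBelow-Λ : ∀ {n t} → FreeBelow (suc n) t → FreeBelow n (Λ t)
FreeBelow-Λ fb [] _ here ()
FreeBelow-Λ {n} {t} fb (◂ ∷ p) m (lamV _ v) r = ≡.subst (m <_) (+-suc (lamDepth t p) n) (fb p m v r)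

unbot-bot : ∀ t → t [] ≡ bot → unbot t ≗ Ωt
unbot-bot t r p rewrite r = refl

unbot-root : ∀ t {l} → t [] ≡ l → l ≢ bot → unbot t [] ≡ l
unbot-root t {var _} r _ rewrite r = refl
unbot-root t {lam}   r _ rewrite r = refl
unbot-root t {app}   r _ rewrite r = refl
unbot-root t {bot}   _ l≢bot = ⊥-elim (l≢bot refl)

unbot-child : ∀ t {l} → t [] ≡ l → l ≢ bot → (unbot t ↓ d) ≗ unbot (t ↓ d)
unbot-child t {var _} r _ p rewrite r = refl
unbot-child t {lam}   r _ p rewrite r = refl
unbot-child t {app}   r _ p rewrite r = refl
unbot-child t {bot}   _ l≢bot = ⊥-elim (l≢bot refl)

unbot-BotFree : BotFree t → unbot t ≈ t
unbot-BotFree {t} bf [] _ = unbot-root t refl (bf [] here)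
unbot-BotFree {t} bf (d ∷ p) v = trans (unbot-child t refl ¬bot p) (unbot-BotFree bf↓ p v↓)
  where
  ¬bot = bf [] here
  v↓ = ≈-Valid (≈-reflexive (unbot-child t refl ¬bot)) (Valid-↓ v)
  bf↓ : BotFree (t ↓ d)
  bf↓ q w = bf (d ∷ q) (Valid-∷ (unbot-root t refl ¬bot) v w)

unbot-≈ : t ≈ u → BotFree u → unbot t ≈ u
unbot-≈ e bf = ≈-trans (unbot-BotFree (BotFree-cong e bf)) e

NormalβUS-var : t [] ≡ var n → Solvable (unbot t) → NormalβUS t
NormalβUS-var r _ _ (root (βr (r′ , _))) = clash r r′ λ ()
NormalβUS-var _ s _ (root (⊥r _ ¬s _))   = ¬s s
NormalβUS-var r _ _ (lamc r′ _ _)        = clash r r′ λ ()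
NormalβUS-var r _ _ (appl r′ _ _ _)      = clash r r′ λ ()
NormalβUS-var r _ _ (appr r′ _ _ _)      = clash r r′ λ ()

NormalβUS-lam : t [] ≡ lam → Solvable (unbot t) → NormalβUS (t ↓ ◂) → NormalβUS t
NormalβUS-lam r _ _ _ (root (βr (r′ , _))) = clash r r′ λ ()
NormalβUS-lam _ s _ _ (root (⊥r _ ¬s _))   = ¬s s
NormalβUS-lam _ _ n _ (lamc _ _ c)         = n _ c
NormalβUS-lam r _ _ _ (appl r′ _ _ _)      = clash r r′ λ ()
NormalβUS-lam r _ _ _ (appr r′ _ _ _)      = clash r r′ λ ()

NormalβUS-bot : t [] ≡ bot → NormalβUS t
NormalβUS-bot r _ (root (βr (r′ , _))) = clash r r′ λ ()
NormalβUS-bot r _ (root (⊥r r≢bot _ _)) = r≢bot r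
NormalβUS-bot r _ (lamc r′ _ _)        = clash r r′ λ ()
NormalβUS-bot r _ (appl r′ _ _ _)      = clash r r′ λ ()
NormalβUS-bot r _ (appr r′ _ _ _)      = clash r r′ λ ()

NormalβUS-body : NormalβUS t → t [] ≡ lam → NormalβUS (t ↓ ◂)
NormalβUS-body n r v c = n (Λ v) (lamc r refl c)

NormalβUS-child : NormalβUS t → t [] ≡ app → ∀ d → NormalβUS (t ↓ d)
NormalβUS-child {t} n r ◂ v c = n (v · (t ↓ ▸)) (appl r refl c ≈-refl)
NormalβUS-child {t} n r ▸ v c = n ((t ↓ ◂) · v) (appr r refl ≈-refl c)

NormalβUS-¬redex : NormalβUS t → t [] ≡ app → (t ↓ ◂) [] ≢ lam
NormalβUS-¬redex n r r′ = n _ (root (βr (r , r′ , ≈-refl)))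

NormalβUS-V0 : t ≈ V 0 → NormalβUS t
NormalβUS-V0 e = NormalβUS-var (≈-root e)
  (1 , FreeBelow-cong e′ (FreeBelow-V (s≤s z≤n)) , SolvableClosed-It (Λ-cong e′))
  where e′ = unbot-≈ e (BotFree-V 0)

NormalβUS-V1 : t ≈ V 1 → NormalβUS t
NormalβUS-V1 e = NormalβUS-var (≈-root e)
  (2 , FreeBelow-cong e′ (FreeBelow-V (s≤s (s≤s z≤n))) , SolvableClosed-Tt (Λ-cong (Λ-cong e′)))
  where e′ = unbot-≈ e (BotFree-V 1)

NormalβUS-I : t ≈ It → NormalβUS t
NormalβUS-I e = NormalβUS-lam (≈-root e)
  (0 , FreeBelow-cong e′ (FreeBelow-Λ (FreeBelow-V (s≤s z≤n))) , SolvableClosed-It e′)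
  (NormalβUS-V0 (≈-body e (≈-root e)))
  where e′ = unbot-≈ e (BotFree-Λ (BotFree-V 0))

NormalβUS-ΛV1 : t ≈ Λ (V 1) → NormalβUS t
NormalβUS-ΛV1 e = NormalβUS-lam (≈-root e)
  (1 , FreeBelow-cong e′ (FreeBelow-Λ (FreeBelow-V (s≤s (s≤s z≤n)))) , SolvableClosed-Tt (Λ-cong e′))
  (NormalβUS-V1 (≈-body e (≈-root e)))
  where e′ = unbot-≈ e (BotFree-Λ (BotFree-V 1))

lam-⟶βUS-bot : t [] ≡ lam → NormalβUS (t ↓ ◂) → t ⟶βUS u → u [] ≡ bot
lam-⟶βUS-bot r _ (root (βr (r′ , _))) = clash r r′ λ ()
lam-⟶βUS-bot _ _ (root (⊥r _ _ ub))   = ub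
lam-⟶βUS-bot _ n (lamc _ _ c)         = ⊥-elim (n _ c)
lam-⟶βUS-bot r _ (appl r′ _ _ _)      = clash r r′ λ ()
lam-⟶βUS-bot r _ (appr r′ _ _ _)      = clash r r′ λ ()

-- Reducts of encoded propositions

data Sort : Set where
  boolean operator : Sort

headSort : Sort → Sort
headSort boolean  = operator
headSort operator = boolean

variable
  s : Sort

-- The grammar B, O above: `boolean` is B, `operator` is O, and `app` covers both O B and B B.
data Shape {ℓ} (P : Sort → Term → Set ℓ) : Sort → Term → Set ℓ where
  isT : t ≈ Tt → Shape P boolean t
  isF : t ≈ Ft → Shape P boolean t
  isI : t ≈ It → Shape P operator t
  abs : t [] ≡ lam → P boolean (t ↓ ◂) → Shape P operator t
  app : t [] ≡ app → P (headSort s) (t ↓ ◂) → P boolean (t ↓ ▸) → Shape P s t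
  bot : t [] ≡ bot → Shape P s t

Shape-map : ∀ {ℓ ℓ′} {P : Sort → Term → Set ℓ} {Q : Sort → Term → Set ℓ′} →
            (∀ {s t} → P s t → Q s t) → Shape P s t → Shape Q s t
Shape-map f (isT e)     = isT e
Shape-map f (isF e)     = isF e
Shape-map f (isI e)     = isI e
Shape-map f (abs r x)   = abs r (f x)
Shape-map f (app r x y) = app r (f x) (f y)
Shape-map f (bot r)     = bot r

-- Shaped is the greatest fixed point of Shape, presented by its Set-valued post-fixed points.
-- Since the impredicative proof of Shape νShape ⊆ νShape is not available, fold merges the
-- post-fixed points witnessing the subterms.
record Invariant : Set₁ where
  field
    Holds  : Sort → Term → Set
    closed : ∀ {s t} → Holds s t → Shape Holds s t
open Invariant

Shaped : Sort → Term → Set₁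
Shaped s t = Σ Invariant λ I → Holds I s t

unfold : Shaped s t → Shape Shaped s t
unfold (I , x) = Shape-map (I ,_) (closed I x)

∅ : Invariant
∅ = record { Holds = λ _ _ → Empty ; closed = λ () }

_∪_ : Invariant → Invariant → Invariant
I ∪ J = record
  { Holds  = λ s t → Holds I s t ⊎ Holds J s t
  ; closed = λ { (inj₁ x) → Shape-map inj₁ (closed I x) ; (inj₂ y) → Shape-map inj₂ (closed J y) } }

insert : ∀ I → Shape (Holds I) s t → Shaped s t
insert {s} {t} I sh = record { Holds = Holds′ ; closed = closed′ } , inj₁ (refl , refl)
  where
  Holds′ : Sort → Term → Set
  Holds′ s′ t′ = (s′ ≡ s × t′ ≡ t) ⊎ Holds I s′ t′
  closed′ : ∀ {s t} → Holds′ s t → Shape Holds′ s t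
  closed′ (inj₁ (refl , refl)) = Shape-map inj₂ sh
  closed′ (inj₂ x)             = Shape-map inj₂ (closed I x)

fold : Shape Shaped s t → Shaped s t
fold (isT e)                 = insert ∅ (isT e)
fold (isF e)                 = insert ∅ (isF e)
fold (isI e)                 = insert ∅ (isI e)
fold (bot r)                 = insert ∅ (bot r)
fold (abs r (I , x))         = insert I (abs r x)
fold (app r (I , x) (J , y)) = insert (I ∪ J) (app r (inj₁ x) (inj₂ y))

module _ (M : TreeMap) where
  open TreeMap M

  Shaped-map : ∀ ρ → Shaped s t → u ≈ apply ρ t → Shaped s u
  Shaped-map ρ (I , x) e = record { Holds = Image ; closed = closed′ } , (ρ , _ , x , e)
    where
    Image : Sort → Term → Set
    Image s u = Σ Env λ ρ → Σ Term λ t → Holds I s t × u ≈ apply ρ t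
    closed′ : ∀ {s u} → Image s u → Shape Image s u
    closed′ (ρ , t , x , e) with closed I x
    ... | isT t≈ = isT (≈-trans e (≈-trans (apply-cong ρ t≈) (apply-Tt ρ)))
    ... | isF t≈ = isF (≈-trans e (≈-trans (apply-cong ρ t≈) (apply-Ft ρ)))
    ... | isI t≈ = isI (≈-trans e (≈-trans (apply-cong ρ t≈) (apply-It ρ)))
    ... | abs r y = abs r′ (under ρ , _ , y , ≈-trans (≈-body e r′) (≈-reflexive (apply-body ρ t r)))
      where r′ = trans (≈-root e) (apply-root ρ t r λ _ ())
    ... | app r y z = app r′ (ρ , _ , y , ≈-trans (≈-child e r′ ◂) (≈-reflexive (apply-child ρ t ◂ r)))
                             (ρ , _ , z , ≈-trans (≈-child e r′ ▸) (≈-reflexive (apply-child ρ t ▸ r)))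
      where r′ = trans (≈-root e) (apply-root ρ t r λ _ ())
    ... | bot r = bot (trans (≈-root e) (apply-root ρ t r λ _ ()))

Shaped-≈ : Shaped s t → u ≈ t → Shaped s u
Shaped-≈ = Shaped-map id-map _

Shaped-β : Shaped (headSort s) t → Shaped boolean w → t [] ≡ lam → u ≈ ((t ↓ ◂) [ w ]) → Shaped s u
Shaped-β {boolean} x y r e with unfold x
... | isI t≈     = Shaped-≈ y (≈-trans e (It-β t≈))
... | abs _ z    = Shaped-map subst-map _ z e
... | app r′ _ _ = clash r′ r λ ()
... | bot r′     = clash r′ r λ ()
Shaped-β {operator} x y r e with unfold x
... | isT t≈     = let e′ = ≈-trans e (Tt-β t≈) in
                   fold (abs (≈-root e′) (Shaped-map rename-map suc y (≈-body e′ (≈-root e′))))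
... | isF t≈     = fold (isI (≈-trans e (Ft-β t≈)))
... | app r′ _ _ = clash r′ r λ ()
... | bot r′     = clash r′ r λ ()

Shaped-step : Shaped s t → t ⟶βUS u → Shaped s u
Shape-step  : Shape Shaped s t → t ⟶βUS u → Shaped s u

Shaped-step x c = Shape-step (unfold x) c

Shape-step (isT e) c = fold (bot (lam-⟶βUS-bot (≈-root e) (NormalβUS-ΛV1 (≈-body e (≈-root e))) c))
Shape-step (isF e) c = fold (bot (lam-⟶βUS-bot (≈-root e) (NormalβUS-I (≈-body e (≈-root e))) c))
Shape-step (isI e) c = fold (bot (lam-⟶βUS-bot (≈-root e) (NormalβUS-V0 (≈-body e (≈-root e))) c))
Shape-step (bot r) c = ⊥-elim (NormalβUS-bot r _ c)
Shape-step (abs _ x)   (lamc _ r c)            = fold (abs r (Shaped-step x c))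
Shape-step (abs _ _)   (root (⊥r _ _ r))       = fold (bot r)
Shape-step (abs r _)   (root (βr (r′ , _)))    = clash r r′ λ ()
Shape-step (abs r _)   (appl r′ _ _ _)         = clash r r′ λ ()
Shape-step (abs r _)   (appr r′ _ _ _)         = clash r r′ λ ()
Shape-step (app _ x y) (root (βr (_ , r , e))) = Shaped-β x y r e
Shape-step (app _ _ _) (root (⊥r _ _ r))       = fold (bot r)
Shape-step (app r _ _) (lamc r′ _ _)           = clash r r′ λ ()
Shape-step (app _ x y) (appl _ r c t▸≈)        = fold (app r (Shaped-step x c) (Shaped-≈ y (≈-sym t▸≈)))
Shape-step (app _ x y) (appr _ r t◂≈ c)        = fold (app r (Shaped-≈ x (≈-sym t◂≈)) (Shaped-step y c))

Shaped-star : Shaped s t → Star _⟶βUS_ t u → Shaped s u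
Shaped-star x ε        = x
Shaped-star x (c ◅ cs) = Shaped-star (Shaped-step x c) cs

Shaped-¬var : Shaped s t → t [] ≢ var n
Shaped-¬var x r with unfold x
... | isT e      = clash (≈-root e) r λ ()
... | isF e      = clash (≈-root e) r λ ()
... | isI e      = clash (≈-root e) r λ ()
... | abs r′ _   = clash r′ r λ ()
... | app r′ _ _ = clash r′ r λ ()
... | bot r′     = clash r′ r λ ()

Shaped-head : Shaped s t → t [] ≡ app → Shaped (headSort s) (t ↓ ◂)
Shaped-head x r with unfold x
... | isT e      = clash (≈-root e) r λ ()
... | isF e      = clash (≈-root e) r λ ()
... | isI e      = clash (≈-root e) r λ ()
... | abs r′ _   = clash r′ r λ ()
... | app _ y _  = y
... | bot r′     = clash r′ r λ ()

Shaped-boolean-lam : Shaped boolean t → t [] ≡ lam → t ≈ Tt ⊎ t ≈ Ft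
Shaped-boolean-lam x r with unfold x
... | isT e      = inj₁ e
... | isF e      = inj₂ e
... | app r′ _ _ = clash r′ r λ ()
... | bot r′     = clash r′ r λ ()

-- Böhm trees of shaped terms

module _ {S : Term → Term → Set₁} (post : ∀ a b → S a b → UnfoldUS S a b) where

  S-normal⇒≈    : NormalβUS t → S t u → t ≈ u
  Lift-normal⇒≈ : NormalβUS t → Lift S t u → t ≈ u

  S-normal⇒≈ n s p v with post _ _ s
  ... | _ , c ◅ _ , _  = ⊥-elim (n _ c)
  ... | _ , ε , lift   = Lift-normal⇒≈ n lift p v

  Lift-normal⇒≈ _ (var r r′)     []      _ = trans r (sym r′)
  Lift-normal⇒≈ _ (lam r r′ _)   []      _ = trans r (sym r′)
  Lift-normal⇒≈ _ (app r r′ _ _) []      _ = trans r (sym r′)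
  Lift-normal⇒≈ _ (bot r r′)     []      _ = trans r (sym r′)
  Lift-normal⇒≈ n (lam r _ s)    (◂ ∷ p) (lamV _ v) = S-normal⇒≈ (NormalβUS-body n r) s p v
  Lift-normal⇒≈ n (app r _ s _)  (◂ ∷ p) (appV _ v) = S-normal⇒≈ (NormalβUS-child n r ◂) s p v
  Lift-normal⇒≈ n (app r _ _ s)  (▸ ∷ p) (appV _ v) = S-normal⇒≈ (NormalβUS-child n r ▸) s p v
  Lift-normal⇒≈ _ (var r _)      _ (lamV r′ _) = clash r r′ λ ()
  Lift-normal⇒≈ _ (var r _)      _ (appV r′ _) = clash r r′ λ ()
  Lift-normal⇒≈ _ (lam r _ _)    _ (appV r′ _) = clash r r′ λ ()
  Lift-normal⇒≈ _ (app r _ _ _)  _ (lamV r′ _) = clash r r′ λ ()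
  Lift-normal⇒≈ _ (bot r _)      _ (lamV r′ _) = clash r r′ λ ()
  Lift-normal⇒≈ _ (bot r _)      _ (appV r′ _) = clash r r′ λ ()

  Shaped-normal-reduct-ΩSpine : ∀ n → Shaped s t → S t u → NormalβUS u → u [] ≢ lam → ΩSpine n (unbot u)
  Shaped-normal-reduct-ΩSpine zero    _ _ _ _ = _
  Shaped-normal-reduct-ΩSpine {u = u} (suc n) x s nu ¬lam with post _ _ s
  ... | _ , cs , lift with Shaped-star x cs | lift
  ... | x′ | var r _       = ⊥-elim (Shaped-¬var x′ r)
  ... | _  | lam _ r _     = ⊥-elim (¬lam r)
  ... | _  | bot _ r       = inj₁ (≈-reflexive (unbot-bot u r))
  ... | x′ | app r r′ s′ _ =
    inj₂ (unbot-root u r′ (λ ()) ,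
          ΩSpine-cong n (≈-sym (≈-reflexive (unbot-child u r′ λ ())))
            (Shaped-normal-reduct-ΩSpine n (Shaped-head x′ r) s′ (NormalβUS-child nu r′ ◂) (NormalβUS-¬redex nu r′)))

  Shaped-normal-reduct-¬app : Shaped s t → S t u → NormalβUS u → u [] ≢ app
  Shaped-normal-reduct-¬app x s nu r =
    nu ⊥t (root (⊥r (λ r′ → clash r r′ λ ())
                    (SpineDivergent-unsolvable λ n → Shaped-normal-reduct-ΩSpine n x s nu λ r′ → clash r r′ λ ())
                    refl))

  Shaped-normal-reduct : Shaped boolean t → S t u → NormalβUS u → u ≈ Tt ⊎ (u ≈ Ft ⊎ u ≈ ⊥t)
  Shaped-normal-reduct x s nu with post _ _ s
  ... | _ , cs , lift with Shaped-star x cs | lift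
  ... | x′ | var r _      = ⊥-elim (Shaped-¬var x′ r)
  ... | _  | bot _ r      = inj₂ (inj₂ (≈-bot r))
  ... | _  | app _ r _ _  = ⊥-elim (Shaped-normal-reduct-¬app x s nu r)
  ... | x′ | lam r r′ s′ with Shaped-boolean-lam x′ r
  ...   | inj₁ e = inj₁ (≈-lam r′ (≈-trans (≈-sym (S-normal⇒≈ (NormalβUS-ΛV1 (≈-body e r)) s′)) (≈-body e r)))
  ...   | inj₂ e = inj₂ (inj₁ (≈-lam r′ (≈-trans (≈-sym (S-normal⇒≈ (NormalβUS-I (≈-body e r)) s′)) (≈-body e r))))

data Connective : PLabel → Set where
  and : Connective pand
  or  : Connective por
  imp : Connective pimp
  neg : Connective pneg

constant : PLabel → Proposition
constant k _ = k

innerArg outerArg : (φ : Proposition) → ∀ {k} → Connective k → Proposition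
innerArg φ and = φ ↓ₚ ▸
innerArg φ or  = φ ↓ₚ ◂
innerArg φ imp = φ ↓ₚ ▸
innerArg φ neg = constant pF
outerArg φ and = φ ↓ₚ ◂
outerArg φ or  = φ ↓ₚ ▸
outerArg φ imp = constant pT
outerArg φ neg = constant pT

enc-T : ∀ φ → φ [] ≡ pT → enc φ ≗ Tt
enc-T φ r p rewrite r = refl

enc-F : ∀ φ → φ [] ≡ pF → enc φ ≗ Ft
enc-F φ r p rewrite r = refl

enc-connective : ∀ φ {k} → φ [] ≡ k → (c : Connective k) →
                 enc φ ≗ (enc (φ ↓ₚ ◂) · enc (innerArg φ c) · enc (outerArg φ c))
-- `inner` inspects the root label again, hence the second rewrite.
enc-connective φ r and []            rewrite r = refl
enc-connective φ r and (◂ ∷ [])      rewrite r = refl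
enc-connective φ r and (◂ ∷ ◂ ∷ _)   rewrite r = refl
enc-connective φ r and (◂ ∷ ▸ ∷ _)   rewrite r | r = refl
enc-connective φ r and (▸ ∷ _)       rewrite r = refl
enc-connective φ r or  []            rewrite r = refl
enc-connective φ r or  (◂ ∷ [])      rewrite r = refl
enc-connective φ r or  (◂ ∷ ◂ ∷ _)   rewrite r = refl
enc-connective φ r or  (◂ ∷ ▸ ∷ _)   rewrite r | r = refl
enc-connective φ r or  (▸ ∷ _)       rewrite r = refl
enc-connective φ r imp []            rewrite r = refl
enc-connective φ r imp (◂ ∷ [])      rewrite r = refl
enc-connective φ r imp (◂ ∷ ◂ ∷ _)   rewrite r = refl
enc-connective φ r imp (◂ ∷ ▸ ∷ _)   rewrite r | r = refl
enc-connective φ r imp (▸ ∷ _)       rewrite r = refl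
enc-connective φ r neg []            rewrite r = refl
enc-connective φ r neg (◂ ∷ [])      rewrite r = refl
enc-connective φ r neg (◂ ∷ ◂ ∷ _)   rewrite r = refl
enc-connective φ r neg (◂ ∷ ▸ ∷ _)   rewrite r | r = refl
enc-connective φ r neg (▸ ∷ _)       rewrite r = refl

ClosedProp-↓ : ∀ {φ d} → ClosedProp φ → (∀ {p} → ValidP (φ ↓ₚ d) p → ValidP φ (d ∷ p)) → ClosedProp (φ ↓ₚ d)
ClosedProp-↓ cl extend p n v = cl _ n (extend v)

ClosedProp-T : ClosedProp (constant pT)
ClosedProp-T _ _ here ()
ClosedProp-T _ _ (binV (inj₁ ()) _)
ClosedProp-T _ _ (binV (inj₂ (inj₁ ())) _)
ClosedProp-T _ _ (binV (inj₂ (inj₂ ())) _)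
ClosedProp-T _ _ (negV () _)

ClosedProp-F : ClosedProp (constant pF)
ClosedProp-F _ _ here ()
ClosedProp-F _ _ (binV (inj₁ ()) _)
ClosedProp-F _ _ (binV (inj₂ (inj₁ ())) _)
ClosedProp-F _ _ (binV (inj₂ (inj₂ ())) _)
ClosedProp-F _ _ (negV () _)

module _ {φ : Proposition} (cl : ClosedProp φ) {k} (r : φ [] ≡ k) where

  ClosedProp-◂ : Connective k → ClosedProp (φ ↓ₚ ◂)
  ClosedProp-◂ and = ClosedProp-↓ cl (binV (inj₁ r))
  ClosedProp-◂ or  = ClosedProp-↓ cl (binV (inj₂ (inj₁ r)))
  ClosedProp-◂ imp = ClosedProp-↓ cl (binV (inj₂ (inj₂ r)))
  ClosedProp-◂ neg = ClosedProp-↓ cl (negV r)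

  ClosedProp-innerArg : (c : Connective k) → ClosedProp (innerArg φ c)
  ClosedProp-innerArg and = ClosedProp-↓ cl (binV (inj₁ r))
  ClosedProp-innerArg or  = ClosedProp-↓ cl (binV (inj₂ (inj₁ r)))
  ClosedProp-innerArg imp = ClosedProp-↓ cl (binV (inj₂ (inj₂ r)))
  ClosedProp-innerArg neg = ClosedProp-F

  ClosedProp-outerArg : (c : Connective k) → ClosedProp (outerArg φ c)
  ClosedProp-outerArg and = ClosedProp-↓ cl (binV (inj₁ r))
  ClosedProp-outerArg or  = ClosedProp-↓ cl (binV (inj₂ (inj₁ r)))
  ClosedProp-outerArg imp = ClosedProp-T
  ClosedProp-outerArg neg = ClosedProp-T

Encoded : Sort → Term → Set
Encoded boolean  t = ∃[ φ ] ClosedProp φ × t ≈ enc φ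
Encoded operator t = ∃[ φ ] ∃[ ψ ] (ClosedProp φ × ClosedProp ψ) × t ≈ (enc φ · enc ψ)

Encoded-connective : ∀ {φ k t} → ClosedProp φ → φ [] ≡ k → (c : Connective k) → t ≈ enc φ →
                     Shape Encoded boolean t
Encoded-connective {φ} cl r c e =
  app (≈-root e′)
      (φ ↓ₚ ◂ , innerArg φ c , (ClosedProp-◂ cl r c , ClosedProp-innerArg cl r c) , ≈-child e′ (≈-root e′) ◂)
      (outerArg φ c , ClosedProp-outerArg cl r c , ≈-child e′ (≈-root e′) ▸)
  where e′ = ≈-trans e (≈-reflexive (enc-connective φ r c))

Encoded-boolean : ∀ {φ k t} → ClosedProp φ → φ [] ≡ k → t ≈ enc φ → Shape Encoded boolean t
Encoded-boolean {φ} {pvar n} cl r e = ⊥-elim (cl [] n here r)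
Encoded-boolean {φ} {pT}     cl r e = isT (≈-trans e (≈-reflexive (enc-T φ r)))
Encoded-boolean {φ} {pF}     cl r e = isF (≈-trans e (≈-reflexive (enc-F φ r)))
Encoded-boolean {φ} {pand}   cl r e = Encoded-connective cl r and e
Encoded-boolean {φ} {por}    cl r e = Encoded-connective cl r or e
Encoded-boolean {φ} {pimp}   cl r e = Encoded-connective cl r imp e
Encoded-boolean {φ} {pneg}   cl r e = Encoded-connective cl r neg e

Encoded-closed : ∀ {s t} → Encoded s t → Shape Encoded s t
Encoded-closed {boolean} (φ , cl , e) = Encoded-boolean cl refl e
Encoded-closed {operator} (φ , ψ , (clφ , clψ) , e) =
  app (≈-root e) (φ , clφ , ≈-child e (≈-root e) ◂) (ψ , clψ , ≈-child e (≈-root e) ▸)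

enc-Shaped : ∀ {φ} → ClosedProp φ → Shaped boolean (enc φ)
enc-Shaped {φ} cl = record { Holds = Encoded ; closed = Encoded-closed } , (φ , cl , ≈-refl)

theorem3 : (φ : Proposition) → ClosedProp φ → (B : Term) → BöhmTree (enc φ) B →
    B ≈ Tt ⊎ (B ≈ Ft ⊎ B ≈ ⊥t)
theorem3 φ cl B ((S , s , post) , B-normal) = Shaped-normal-reduct post (enc-Shaped cl) s B-normal
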